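{- Let $v\geq 1$ and, for $i=1,\dots,v$, let $A_i=\begin{bmatrix}0&\epsilon_i\\ 1&\alpha_i\end{bmatrix}$ with $\epsilon_i\in\{ -1,1\}$, $\alpha_i\in\mathbb{Z}$. Let $P_1,P_2$ be finite words in $A_1,\dots,A_v$ satisfying the conditions in the context, let $(q_m)_{m\ge1}$ be positive integers, define $P_{m+2}=P_{m+1}^{q_m}P_m=\begin{bmatrix}a_{m+2}&b_{m+2}\\ c_{m+2}&d_{m+2}\end{bmatrix}$ for $m\ge1$, and let $Q_n=\begin{bmatrix}e_n&f_n\\ g_n&h_n\end{bmatrix}$ be the product of the first $n$ letters of $P_m$ for any $m\ge2$ with $k_m\ge n$. Suppose that for all sufficiently large $m$ we have $|b_m|=|c_m|=|d_m|-1=|a_m|+1$. Then there exists $D>0$ such that $|e_n|,|f_n|,|g_n|,|h_n|<Dn$ for all $n\in\mathbb{N}$.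
   Context: Conditions on $P_1,P_2$: writing $P_i=\begin{bmatrix}a_i&b_i\\ c_i&d_i\end{bmatrix}$ for the matrix product of the word, $|d_i|\ge2$, $b_i\ne0$, $c_i\ne0$ and $0\le\frac{|a_i|}{|b_i|},\frac{|c_i|}{|d_i|},\frac{|a_i|}{|c_i|},\frac{|b_i|}{|d_i|}\le1$ for $i=1,2$. $k_m$ is the length of the word $P_m$; since $P_{m+2}$ begins with $P_{m+1}$, the first $n$ letters of $P_m$ agree for all $m\ge2$ with $k_m\ge n$. -}

module Defs where

open import Data.Nat using (ℕ; zero; suc; _≤_; _<_; _+_)
open import Data.Integer using (ℤ; +_; -_; ∣_∣) renaming (_+_ to _+ℤ_; _*_ to _*ℤ_)
open import Data.Fin using (Fin)
open import Data.List using (List; []; _∷_; _++_; foldr; length; take)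
open import Data.Product using (_×_)
open import Relation.Binary.PropositionalEquality using (_≡_)
open import Relation.Nullary using (¬_)

record M2 : Set where
  constructor mat
  field
    a b c d : ℤ
open M2 public

_⊗_ : M2 → M2 → M2
mat a₁ b₁ c₁ d₁ ⊗ mat a₂ b₂ c₂ d₂ =
  mat (a₁ *ℤ a₂ +ℤ b₁ *ℤ c₂) (a₁ *ℤ b₂ +ℤ b₁ *ℤ d₂)
      (c₁ *ℤ a₂ +ℤ d₁ *ℤ c₂) (c₁ *ℤ b₂ +ℤ d₁ *ℤ d₂)

I₂ : M2
I₂ = mat (+ 1) (+ 0) (+ 0) (+ 1)

letter : {v : ℕ} → (Fin v → ℤ) → (Fin v → ℤ) → Fin v → M2
letter ε α i = mat (+ 0) (ε i) (+ 1) (α i)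

wordMat : {v : ℕ} → (Fin v → ℤ) → (Fin v → ℤ) → List (Fin v) → M2
wordMat ε α = foldr (λ i M → letter ε α i ⊗ M) I₂

wpow : {A : Set} → List A → ℕ → List A
wpow w zero = []
wpow w (suc q) = w ++ wpow w q

-- P m for m ≥ 1 (index 0 is an unused dummy):
-- P 1 = w₁, P 2 = w₂, P (m+2) = P (m+1) ^ (q m) ++ P m  for m ≥ 1.
Pword : {A : Set} → List A → List A → (ℕ → ℕ) → ℕ → List A
Pword w₁ w₂ q zero = []
Pword w₁ w₂ q (suc zero) = w₁
Pword w₁ w₂ q (suc (suc zero)) = w₂
Pword w₁ w₂ q (suc (suc (suc m))) =
  wpow (Pword w₁ w₂ q (suc (suc m))) (q (suc m)) ++ Pword w₁ w₂ q (suc m)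

-- The conditions of the context on P_i = [ a b ; c d ]:
-- |d| ≥ 2, b ≠ 0, c ≠ 0, and |a|/|b|, |c|/|d|, |a|/|c|, |b|/|d| ≤ 1
-- (denominators are nonzero, so the ratio conditions are cross-multiplied).
GoodMat : M2 → Set
GoodMat (mat a b c d) =
  (2 ≤ ∣ d ∣) × (¬ b ≡ + 0) × (¬ c ≡ + 0) ×
  (∣ a ∣ ≤ ∣ b ∣) × (∣ c ∣ ≤ ∣ d ∣) × (∣ a ∣ ≤ ∣ c ∣) × (∣ b ∣ ≤ ∣ d ∣)

EqCond : M2 → Set
EqCond (mat a b c d) =
  (∣ b ∣ ≡ ∣ c ∣) × (∣ d ∣ ≡ ∣ b ∣ + 1) × (∣ b ∣ ≡ ∣ a ∣ + 1)

-- For large m the matrix P_m has determinant ±1 and |b| = |c| = |d| − 1 = |a| + 1, which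
-- leaves four sign patterns (shapes). A linear map Φ with 2 Φ(A B) = Φ(A) Φ(B) sends each shape to
-- ±2 times a nonnegative matrix with its own zero pattern, and zero patterns multiply as Boolean matrices;
-- comparing zero patterns in P_{m+2} = P_{m+1}^q P_m shows that eventually every P_m has the same shape,
-- U or L. Those shapes are conjugate, by one fixed shear, to upper triangular matrices with diagonal ±1,
-- whose corner entries are subadditive under products; hence the corner of P_m grows at most linearly in
-- the length of P_m. A prefix of P_m is a product of whole P_j followed by a prefix of one of two fixed
-- words, which gives the linear bound on its entries.
module Submission where

open import Defs
open import Algebra.Bundles using (CommutativeSemiring)
open import Algebra.Bundles.Raw using (RawSemiring)
open import Data.Bool using (Bool; true; false; _∧_; _∨_)
open import Data.Bool.Properties using (∨-∧-commutativeSemiring)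
open import Data.Fin using (Fin)
open import Data.Integer using (ℤ; +_; -_; ∣_∣)
import Data.Integer.Properties as ℤₚ
open import Data.Integer.Tactic.RingSolver using (solve-∀)
open import Data.List using (List; []; _∷_; _++_; length; take)
open import Data.List.Properties using (++-assoc; ++-identityʳ; length-++; length-take)
open import Data.Maybe using (Maybe; just; nothing)
open import Data.Nat as ℕ using (ℕ; zero; suc; _≤_; _<_; _≥_; z≤n; s≤s)
import Data.Nat.Properties as ℕₚ
import Data.Nat.Tactic.RingSolver as ℕ-Solver
open import Data.Product using (∃-syntax; _×_; _,_; proj₁; proj₂)
open import Data.Sum using (_⊎_; inj₁; inj₂)
open import Level using (0ℓ)
open import Relation.Binary.PropositionalEquality

module IntegerMatrices where

  open import Data.Integer using (_+_; _*_; _-_)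

  mat-≡ : ∀ {a b c d a′ b′ c′ d′} → a ≡ a′ → b ≡ b′ → c ≡ c′ → d ≡ d′ → mat a b c d ≡ mat a′ b′ c′ d′
  mat-≡ refl refl refl refl = refl

  ⊗-assoc : ∀ A B C → (A ⊗ B) ⊗ C ≡ A ⊗ (B ⊗ C)
  ⊗-assoc (mat a b c d) (mat e f g h) (mat i j k l) =
    mat-≡ (entry a b e f g h i k) (entry a b e f g h j l) (entry c d e f g h i k) (entry c d e f g h j l)
    where
    entry : ∀ a b e f g h i k → (a * e + b * g) * i + (a * f + b * h) * k ≡ a * (e * i + f * k) + b * (g * i + h * k)
    entry = solve-∀

  ⊗-identityˡ : ∀ A → I₂ ⊗ A ≡ A
  ⊗-identityˡ (mat a b c d) = mat-≡ (first a c) (first b d) (second a c) (second b d)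
    where
    first : ∀ x y → + 1 * x + + 0 * y ≡ x
    first = solve-∀
    second : ∀ x y → + 0 * x + + 1 * y ≡ y
    second = solve-∀

  infixr 30 _⊗^_
  _⊗^_ : M2 → ℕ → M2
  A ⊗^ zero = I₂
  A ⊗^ suc r = A ⊗ A ⊗^ r

  infixr 6 _·_
  _·_ : ℤ → M2 → M2
  u · mat a b c d = mat (u * a) (u * b) (u * c) (u * d)

  module _ {v : ℕ} (ε α : Fin v → ℤ) where

    wordMat-++ : ∀ xs ys → wordMat ε α (xs ++ ys) ≡ wordMat ε α xs ⊗ wordMat ε α ys
    wordMat-++ [] ys = sym (⊗-identityˡ (wordMat ε α ys))
    wordMat-++ (x ∷ xs) ys = trans (cong (letter ε α x ⊗_) (wordMat-++ xs ys))
                                   (sym (⊗-assoc (letter ε α x) (wordMat ε α xs) (wordMat ε α ys)))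

    wordMat-wpow : ∀ w r → wordMat ε α (wpow w r) ≡ wordMat ε α w ⊗^ r
    wordMat-wpow w zero = refl
    wordMat-wpow w (suc r) = trans (wordMat-++ w (wpow w r)) (cong (wordMat ε α w ⊗_) (wordMat-wpow w r))

  IsSign : ℤ → Set
  IsSign u = u ≡ + 1 ⊎ u ≡ - + 1

  IsSign-* : ∀ {u w} → IsSign u → IsSign w → IsSign (u * w)
  IsSign-* (inj₁ refl) (inj₁ refl) = inj₁ refl
  IsSign-* (inj₁ refl) (inj₂ refl) = inj₂ refl
  IsSign-* (inj₂ refl) (inj₁ refl) = inj₂ refl
  IsSign-* (inj₂ refl) (inj₂ refl) = inj₁ refl

  IsSign⇒∣u∣≡1 : ∀ {u} → IsSign u → ∣ u ∣ ≡ 1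
  IsSign⇒∣u∣≡1 (inj₁ refl) = refl
  IsSign⇒∣u∣≡1 (inj₂ refl) = refl

  IsSign⇒∣u*i∣≡∣i∣ : ∀ {u} → IsSign u → ∀ i → ∣ u * i ∣ ≡ ∣ i ∣
  IsSign⇒∣u*i∣≡∣i∣ {u} hu i =
    trans (ℤₚ.abs-* u i) (trans (cong (ℕ._* ∣ i ∣) (IsSign⇒∣u∣≡1 hu)) (ℕₚ.*-identityˡ ∣ i ∣))

  IsSign⇒u*[u*i]≡i : ∀ {u} → IsSign u → ∀ i → u * (u * i) ≡ i
  IsSign⇒u*[u*i]≡i (inj₁ refl) = solve-∀
  IsSign⇒u*[u*i]≡i (inj₂ refl) = solve-∀

  i≡sign*∣i∣ : ∀ i → ∃[ s ] IsSign s × i ≡ s * + ∣ i ∣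
  i≡sign*∣i∣ i with ℤₚ.+∣i∣≡i⊎+∣i∣≡-i i
  ... | inj₁ e = + 1 , inj₁ refl , sym (trans (ℤₚ.*-identityˡ _) e)
  ... | inj₂ e = - + 1 , inj₂ refl , sym (trans (ℤₚ.-1*i≡-i _) (trans (cong -_ e) (ℤₚ.neg-involutive i)))

  det : M2 → ℤ
  det (mat a b c d) = a * d - b * c

  det-⊗ : ∀ A B → det (A ⊗ B) ≡ det A * det B
  det-⊗ (mat a b c d) (mat e f g h) = expand a b c d e f g h
    where
    expand : ∀ a b c d e f g h →
             (a * e + b * g) * (c * f + d * h) - (a * f + b * h) * (c * e + d * g) ≡ (a * d - b * c) * (e * h - f * g)
    expand = solve-∀

  det-sign· : ∀ {u} → IsSign u → ∀ A → det (u · A) ≡ det A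
  det-sign· {u} hu (mat a b c d) =
    trans (expand u a b c d) (trans (ℤₚ.*-assoc u u _) (IsSign⇒u*[u*i]≡i hu (a * d - b * c)))
    where
    expand : ∀ u a b c d → (u * a) * (u * d) - (u * b) * (u * c) ≡ (u * u) * (a * d - b * c)
    expand = solve-∀

  det-wordMat : ∀ {v} (ε α : Fin v → ℤ) → (∀ i → IsSign (ε i)) → ∀ w → IsSign (det (wordMat ε α w))
  det-wordMat ε α ε-sign [] = inj₁ refl
  det-wordMat ε α ε-sign (x ∷ w) =
    subst IsSign (sym (det-⊗ (letter ε α x) (wordMat ε α w)))
          (IsSign-* (det-letter {a = α x} (ε-sign x)) (det-wordMat ε α ε-sign w))
    where
    det-letter : ∀ {e a} → IsSign e → IsSign (det (mat (+ 0) e (+ 1) a))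
    det-letter (inj₁ refl) = inj₂ refl
    det-letter (inj₂ refl) = inj₁ refl

  ‖_‖ : M2 → ℕ
  ‖ mat a b c d ‖ = ∣ a ∣ ℕ.⊔ ∣ b ∣ ℕ.⊔ ∣ c ∣ ℕ.⊔ ∣ d ∣

  entries≤‖‖ : ∀ Z → ∣ M2.a Z ∣ ≤ ‖ Z ‖ × ∣ M2.b Z ∣ ≤ ‖ Z ‖ × ∣ M2.c Z ∣ ≤ ‖ Z ‖ × ∣ M2.d Z ∣ ≤ ‖ Z ‖
  entries≤‖‖ (mat a b c d) =
    ℕₚ.≤-trans (ℕₚ.m≤m⊔n ∣ a ∣ ∣ b ∣) (ℕₚ.≤-trans (ℕₚ.m≤m⊔n _ ∣ c ∣) (ℕₚ.m≤m⊔n _ ∣ d ∣)) ,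
    ℕₚ.≤-trans (ℕₚ.m≤n⊔m ∣ a ∣ ∣ b ∣) (ℕₚ.≤-trans (ℕₚ.m≤m⊔n _ ∣ c ∣) (ℕₚ.m≤m⊔n _ ∣ d ∣)) ,
    ℕₚ.≤-trans (ℕₚ.m≤n⊔m _ ∣ c ∣) (ℕₚ.m≤m⊔n _ ∣ d ∣) ,
    ℕₚ.m≤n⊔m _ ∣ d ∣

  ‖‖-least : ∀ {K} Z → ∣ M2.a Z ∣ ≤ K → ∣ M2.b Z ∣ ≤ K → ∣ M2.c Z ∣ ≤ K → ∣ M2.d Z ∣ ≤ K → ‖ Z ‖ ≤ K
  ‖‖-least (mat a b c d) a≤ b≤ c≤ d≤ = ℕₚ.⊔-lub (ℕₚ.⊔-lub (ℕₚ.⊔-lub a≤ b≤) c≤) d≤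

  ‖‖-⊗ : ∀ A B → ‖ A ⊗ B ‖ ≤ 2 ℕ.* (‖ A ‖ ℕ.* ‖ B ‖)
  ‖‖-⊗ A@(mat a b c d) B@(mat e f g h) with entries≤‖‖ A | entries≤‖‖ B
  ... | a≤ , b≤ , c≤ , d≤ | e≤ , f≤ , g≤ , h≤ =
    ‖‖-least (A ⊗ B) (entry a e b g a≤ e≤ b≤ g≤) (entry a f b h a≤ f≤ b≤ h≤)
                     (entry c e d g c≤ e≤ d≤ g≤) (entry c f d h c≤ f≤ d≤ h≤)
    where
    entry : ∀ x y z w → ∣ x ∣ ≤ ‖ A ‖ → ∣ y ∣ ≤ ‖ B ‖ → ∣ z ∣ ≤ ‖ A ‖ → ∣ w ∣ ≤ ‖ B ‖ →
            ∣ x * y + z * w ∣ ≤ 2 ℕ.* (‖ A ‖ ℕ.* ‖ B ‖)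
    entry x y z w x≤ y≤ z≤ w≤ = begin
      ∣ x * y + z * w ∣                   ≤⟨ ℤₚ.∣i+j∣≤∣i∣+∣j∣ (x * y) (z * w) ⟩
      ∣ x * y ∣ ℕ.+ ∣ z * w ∣             ≡⟨ cong₂ ℕ._+_ (ℤₚ.abs-* x y) (ℤₚ.abs-* z w) ⟩
      ∣ x ∣ ℕ.* ∣ y ∣ ℕ.+ ∣ z ∣ ℕ.* ∣ w ∣ ≤⟨ ℕₚ.+-mono-≤ (ℕₚ.*-mono-≤ x≤ y≤) (ℕₚ.*-mono-≤ z≤ w≤) ⟩
      ‖ A ‖ ℕ.* ‖ B ‖ ℕ.+ ‖ A ‖ ℕ.* ‖ B ‖ ≡⟨ cong (‖ A ‖ ℕ.* ‖ B ‖ ℕ.+_) (sym (ℕₚ.+-identityʳ _)) ⟩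
      2 ℕ.* (‖ A ‖ ℕ.* ‖ B ‖)             ∎
      where open ℕₚ.≤-Reasoning

open IntegerMatrices

module Classification where

  open import Data.Integer using (_+_; _*_)

  signPattern : ℤ → ℤ → ℤ → ℤ → M2
  signPattern sa sb sc x = mat (sa * x) (sb * (+ 1 + x)) (sc * (+ 1 + x)) (+ 2 + x)

  -- The four sign patterns compatible with det = ±1, normalised to d > 0.
  data Shape : Set where
    U L X Y : Shape

  shapeMat : Shape → ℤ → M2
  shapeMat U = signPattern (- + 1) (+ 1) (- + 1)
  shapeMat L = signPattern (- + 1) (- + 1) (+ 1)
  shapeMat X = signPattern (+ 1) (- + 1) (- + 1)
  shapeMat Y = signPattern (+ 1) (+ 1) (+ 1)

  -- When x ≥ 1, the other four patterns have determinant ±(2(x+1)² − 1).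
  signPattern-shape : ∀ {sa sb sc} k → IsSign sa → IsSign sb → IsSign sc →
                      IsSign (det (signPattern sa sb sc (+ k))) →
                      ∃[ τ ] signPattern sa sb sc (+ k) ≡ shapeMat τ (+ k)
  signPattern-shape k (inj₂ refl) (inj₁ refl) (inj₂ refl) _ = U , refl
  signPattern-shape k (inj₂ refl) (inj₂ refl) (inj₁ refl) _ = L , refl
  signPattern-shape k (inj₁ refl) (inj₂ refl) (inj₂ refl) _ = X , refl
  signPattern-shape k (inj₁ refl) (inj₁ refl) (inj₁ refl) _ = Y , refl
  signPattern-shape zero (inj₁ refl) (inj₁ refl) (inj₂ refl) _ = U , refl
  signPattern-shape zero (inj₁ refl) (inj₂ refl) (inj₁ refl) _ = L , refl
  signPattern-shape zero (inj₂ refl) (inj₂ refl) (inj₂ refl) _ = X , refl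
  signPattern-shape zero (inj₂ refl) (inj₁ refl) (inj₁ refl) _ = Y , refl
  signPattern-shape (suc k) (inj₁ refl) (inj₁ refl) (inj₂ refl) (inj₁ ())
  signPattern-shape (suc k) (inj₁ refl) (inj₁ refl) (inj₂ refl) (inj₂ ())
  signPattern-shape (suc k) (inj₁ refl) (inj₂ refl) (inj₁ refl) (inj₁ ())
  signPattern-shape (suc k) (inj₁ refl) (inj₂ refl) (inj₁ refl) (inj₂ ())
  signPattern-shape (suc k) (inj₂ refl) (inj₂ refl) (inj₂ refl) (inj₁ ())
  signPattern-shape (suc k) (inj₂ refl) (inj₂ refl) (inj₂ refl) (inj₂ ())
  signPattern-shape (suc k) (inj₂ refl) (inj₁ refl) (inj₁ refl) (inj₁ ())
  signPattern-shape (suc k) (inj₂ refl) (inj₁ refl) (inj₁ refl) (inj₂ ())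

  record Classified (Z : M2) : Set where
    field
      shape : Shape
      size : ℕ
      scale : ℤ
      scale-sign : IsSign scale
      classified : Z ≡ scale · shapeMat shape (+ size)

  classify : ∀ Z → EqCond Z → IsSign (det Z) → Classified Z
  classify (mat a b c d) (∣b∣≡∣c∣ , ∣d∣≡∣b∣+1 , ∣b∣≡∣a∣+1) det-sign
    with i≡sign*∣i∣ a | i≡sign*∣i∣ b | i≡sign*∣i∣ c | i≡sign*∣i∣ d
  ... | sa , sa-sign , a≡ | sb , sb-sign , b≡ | sc , sc-sign , c≡ | sd , sd-sign , d≡ = record
    { shape = proj₁ shape-found
    ; size = n
    ; scale = sd
    ; scale-sign = sd-sign
    ; classified = trans Z≡sd·P (cong (sd ·_) (proj₂ shape-found))
    }
    where
    n : ℕ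
    n = ∣ a ∣
    P : M2
    P = signPattern (sd * sa) (sd * sb) (sd * sc) (+ n)
    ∣b∣≡1+n : + ∣ b ∣ ≡ + 1 + + n
    ∣b∣≡1+n = cong +_ (trans ∣b∣≡∣a∣+1 (ℕₚ.+-comm n 1))
    ∣d∣≡2+n : + ∣ d ∣ ≡ + 2 + + n
    ∣d∣≡2+n = cong +_ (trans ∣d∣≡∣b∣+1 (trans (cong (ℕ._+ 1) ∣b∣≡∣a∣+1) (trans (ℕₚ.+-assoc n 1 1) (ℕₚ.+-comm n 2))))
    pull-sd : ∀ t y → t * y ≡ sd * ((sd * t) * y)
    pull-sd t y = sym (trans (cong (sd *_) (ℤₚ.*-assoc sd t y)) (IsSign⇒u*[u*i]≡i sd-sign (t * y)))
    Z≡sd·P : mat a b c d ≡ sd · P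
    Z≡sd·P = mat-≡ (trans a≡ (pull-sd sa (+ n)))
                   (trans b≡ (trans (cong (sb *_) ∣b∣≡1+n) (pull-sd sb _)))
                   (trans c≡ (trans (cong (sc *_) (trans (cong +_ (sym ∣b∣≡∣c∣)) ∣b∣≡1+n)) (pull-sd sc _)))
                   (trans d≡ (cong (sd *_) ∣d∣≡2+n))
    shape-found : ∃[ τ ] P ≡ shapeMat τ (+ n)
    shape-found = signPattern-shape n (IsSign-* sd-sign sa-sign) (IsSign-* sd-sign sb-sign) (IsSign-* sd-sign sc-sign)
                    (subst IsSign (trans (cong det Z≡sd·P) (det-sign· sd-sign P)) det-sign)

open Classification

record Mat₂ (A : Set) : Set where
  constructor mat₂
  field
    e₁₁ e₁₂ e₂₁ e₂₂ : A

mat₂-≡ : ∀ {A : Set} {a b c d a′ b′ c′ d′ : A} → a ≡ a′ → b ≡ b′ → c ≡ c′ → d ≡ d′ → mat₂ a b c d ≡ mat₂ a′ b′ c′ d′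
mat₂-≡ refl refl refl refl = refl

module MatrixProduct (R : RawSemiring 0ℓ 0ℓ) where

  open RawSemiring R using (Carrier; 0#; 1#) renaming (_+_ to _⊕_; _*_ to _⊙_)

  infixr 20 _⊛_
  _⊛_ : Mat₂ Carrier → Mat₂ Carrier → Mat₂ Carrier
  mat₂ a b c d ⊛ mat₂ e f g h =
    mat₂ ((a ⊙ e) ⊕ (b ⊙ g)) ((a ⊙ f) ⊕ (b ⊙ h)) ((c ⊙ e) ⊕ (d ⊙ g)) ((c ⊙ f) ⊕ (d ⊙ h))

  𝟙 : Mat₂ Carrier
  𝟙 = mat₂ 1# 0# 0# 1#

  infixr 30 _⊛^_
  _⊛^_ : Mat₂ Carrier → ℕ → Mat₂ Carrier
  A ⊛^ zero = 𝟙
  A ⊛^ suc r = A ⊛ A ⊛^ r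

open MatrixProduct ℕ.+-*-rawSemiring using () renaming (_⊛_ to _⊗ℕ_; 𝟙 to 𝟙ℕ)
open MatrixProduct (CommutativeSemiring.rawSemiring ∨-∧-commutativeSemiring)
  using () renaming (_⊛_ to _⊗𝔹_; 𝟙 to 𝟙𝔹; _⊛^_ to _⊗𝔹^_)

nonZero : ℕ → Bool
nonZero zero = false
nonZero (suc _) = true

zeroPattern : Mat₂ ℕ → Mat₂ Bool
zeroPattern (mat₂ a b c d) = mat₂ (nonZero a) (nonZero b) (nonZero c) (nonZero d)

zeroPattern-⊗ : ∀ M N → zeroPattern (M ⊗ℕ N) ≡ zeroPattern M ⊗𝔹 zeroPattern N
zeroPattern-⊗ (mat₂ a b c d) (mat₂ e f g h) =
  mat₂-≡ (entry a e b g) (entry a f b h) (entry c e d g) (entry c f d h)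
  where
  nonZero-+ : ∀ m n → nonZero (m ℕ.+ n) ≡ nonZero m ∨ nonZero n
  nonZero-+ zero n = refl
  nonZero-+ (suc m) n = refl
  nonZero-* : ∀ m n → nonZero (m ℕ.* n) ≡ nonZero m ∧ nonZero n
  nonZero-* zero n = refl
  nonZero-* (suc m) zero = cong nonZero (ℕₚ.*-zeroʳ m)
  nonZero-* (suc m) (suc n) = refl
  entry : ∀ x y z w → nonZero (x ℕ.* y ℕ.+ z ℕ.* w) ≡ nonZero x ∧ nonZero y ∨ nonZero z ∧ nonZero w
  entry x y z w = trans (nonZero-+ (x ℕ.* y) (z ℕ.* w)) (cong₂ _∨_ (nonZero-* x y) (nonZero-* z w))

module ZeroPatterns where

  open import Data.Integer using (_+_; _*_; _-_)

  toM2 : Mat₂ ℕ → M2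
  toM2 (mat₂ a b c d) = mat (+ a) (+ b) (+ c) (+ d)

  toM2-⊗ : ∀ M N → toM2 (M ⊗ℕ N) ≡ toM2 M ⊗ toM2 N
  toM2-⊗ (mat₂ a b c d) (mat₂ e f g h) = mat-≡ (cast a e b g) (cast a f b h) (cast c e d g) (cast c f d h)
    where
    cast : ∀ x y z w → + (x ℕ.* y ℕ.+ z ℕ.* w) ≡ + x * + y + + z * + w
    cast x y z w = trans (ℤₚ.pos-+ (x ℕ.* y) (z ℕ.* w)) (cong₂ _+_ (ℤₚ.pos-* x y) (ℤₚ.pos-* z w))

  -- Φ Z = Λ Z Λᵀ with Λ = [ 1 1 ; -1 1 ]; since Λᵀ Λ = 2 I, we get 2 Φ(A B) = Φ A Φ B.
  Φ : M2 → M2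
  Φ (mat a b c d) = mat (a + b + c + d) (- a + b - c + d) (- a - b + c + d) (a - b - c + d)

  Φ-⊗ : ∀ A B → + 2 · Φ (A ⊗ B) ≡ Φ A ⊗ Φ B
  Φ-⊗ (mat a b c d) (mat e f g h) =
    mat-≡ (e₁₁ a b c d e f g h) (e₁₂ a b c d e f g h) (e₂₁ a b c d e f g h) (e₂₂ a b c d e f g h)
    where
    e₁₁ : ∀ a b c d e f g h → + 2 * ((a * e + b * g) + (a * f + b * h) + (c * e + d * g) + (c * f + d * h)) ≡
          (a + b + c + d) * (e + f + g + h) + (- a + b - c + d) * (- e - f + g + h)
    e₁₁ = solve-∀
    e₁₂ : ∀ a b c d e f g h → + 2 * (- (a * e + b * g) + (a * f + b * h) - (c * e + d * g) + (c * f + d * h)) ≡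
          (a + b + c + d) * (- e + f - g + h) + (- a + b - c + d) * (e - f - g + h)
    e₁₂ = solve-∀
    e₂₁ : ∀ a b c d e f g h → + 2 * (- (a * e + b * g) - (a * f + b * h) + (c * e + d * g) + (c * f + d * h)) ≡
          (- a - b + c + d) * (e + f + g + h) + (a - b - c + d) * (- e - f + g + h)
    e₂₁ = solve-∀
    e₂₂ : ∀ a b c d e f g h → + 2 * ((a * e + b * g) - (a * f + b * h) - (c * e + d * g) + (c * f + d * h)) ≡
          (- a - b + c + d) * (- e + f - g + h) + (a - b - c + d) * (e - f - g + h)
    e₂₂ = solve-∀

  2·-injective : ∀ {A B} → + 2 · A ≡ + 2 · B → A ≡ B
  2·-injective {mat a b c d} {mat e f g h} eq =
    mat-≡ (cancel (cong M2.a eq)) (cancel (cong M2.b eq)) (cancel (cong M2.c eq)) (cancel (cong M2.d eq))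
    where
    cancel : ∀ {x y} → + 2 * x ≡ + 2 * y → x ≡ y
    cancel {x} {y} = ℤₚ.*-cancelˡ-≡ (+ 2) x y

  2u·-⊗-2w· : ∀ u w A B → ((+ 2 * u) · A) ⊗ ((+ 2 * w) · B) ≡ + 2 · ((+ 2 * (u * w)) · (A ⊗ B))
  2u·-⊗-2w· u w (mat a b c d) (mat e f g h) =
    mat-≡ (entry u w a e b g) (entry u w a f b h) (entry u w c e d g) (entry u w c f d h)
    where
    entry : ∀ u w x y z t → (+ 2 * u) * x * ((+ 2 * w) * y) + (+ 2 * u) * z * ((+ 2 * w) * t) ≡
            + 2 * ((+ 2 * (u * w)) * (x * y + z * t))
    entry = solve-∀

  -- Zero patterns of nonnegative matrices multiply as Boolean matrices, so β is multiplicative in Z.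
  record HasPattern (Z : M2) (β : Mat₂ Bool) : Set where
    field
      sign : ℤ
      image : Mat₂ ℕ
      sign-ok : IsSign sign
      Φ-image : Φ Z ≡ (+ 2 * sign) · toM2 image
      zero-pattern : zeroPattern image ≡ β

  HasPattern-I : HasPattern I₂ 𝟙𝔹
  HasPattern-I = record { sign = + 1 ; image = 𝟙ℕ ; sign-ok = inj₁ refl ; Φ-image = refl ; zero-pattern = refl }

  HasPattern-⊗ : ∀ {A B α β} → HasPattern A α → HasPattern B β → HasPattern (A ⊗ B) (α ⊗𝔹 β)
  HasPattern-⊗ {A} {B} hA hB = record
    { sign = sign hA * sign hB
    ; image = image hA ⊗ℕ image hB
    ; sign-ok = IsSign-* (sign-ok hA) (sign-ok hB)
    ; Φ-image = 2·-injective (begin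
        + 2 · Φ (A ⊗ B)
          ≡⟨ Φ-⊗ A B ⟩
        Φ A ⊗ Φ B
          ≡⟨ cong₂ _⊗_ (Φ-image hA) (Φ-image hB) ⟩
        ((+ 2 * sign hA) · toM2 (image hA)) ⊗ ((+ 2 * sign hB) · toM2 (image hB))
          ≡⟨ 2u·-⊗-2w· (sign hA) (sign hB) (toM2 (image hA)) (toM2 (image hB)) ⟩
        + 2 · ((+ 2 * (sign hA * sign hB)) · (toM2 (image hA) ⊗ toM2 (image hB)))
          ≡⟨ cong (λ M → + 2 · ((+ 2 * (sign hA * sign hB)) · M)) (sym (toM2-⊗ (image hA) (image hB))) ⟩
        + 2 · ((+ 2 * (sign hA * sign hB)) · toM2 (image hA ⊗ℕ image hB)) ∎)
    ; zero-pattern = trans (zeroPattern-⊗ (image hA) (image hB)) (cong₂ _⊗𝔹_ (zero-pattern hA) (zero-pattern hB))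
    }
    where
    open HasPattern
    open ≡-Reasoning

  HasPattern-⊗^ : ∀ {A α} → HasPattern A α → ∀ r → HasPattern (A ⊗^ r) (α ⊗𝔹^ r)
  HasPattern-⊗^ hA zero = HasPattern-I
  HasPattern-⊗^ hA (suc r) = HasPattern-⊗ hA (HasPattern-⊗^ hA r)

  HasPattern-unique : ∀ {Z α β} → HasPattern Z α → HasPattern Z β → α ≡ β
  HasPattern-unique hα hβ =
    trans (sym (zero-pattern hα))
          (trans (cong zeroPattern (same-image (sign-ok hα) (sign-ok hβ) (trans (sym (Φ-image hα)) (Φ-image hβ))))
                 (zero-pattern hβ))
    where
    open HasPattern
    ∣2s*m∣ : ∀ {s} → IsSign s → ∀ m → ∣ + 2 * s * + m ∣ ≡ 2 ℕ.* m
    ∣2s*m∣ {s} hs m = trans (ℤₚ.abs-* (+ 2 * s) (+ m))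
                            (cong (ℕ._* m) (trans (ℤₚ.abs-* (+ 2) s) (cong (2 ℕ.*_) (IsSign⇒∣u∣≡1 hs))))
    same-image : ∀ {s s′ M N} → IsSign s → IsSign s′ → (+ 2 * s) · toM2 M ≡ (+ 2 * s′) · toM2 N → M ≡ N
    same-image {s} {s′} {mat₂ a b c d} {mat₂ e f g h} hs hs′ eq =
      mat₂-≡ (entry (cong M2.a eq)) (entry (cong M2.b eq)) (entry (cong M2.c eq)) (entry (cong M2.d eq))
      where
      entry : ∀ {m n} → + 2 * s * + m ≡ + 2 * s′ * + n → m ≡ n
      entry {m} {n} e = ℕₚ.*-cancelˡ-≡ m n 2 (trans (sym (∣2s*m∣ hs m)) (trans (cong ∣_∣ e) (∣2s*m∣ hs′ n)))

  shapePattern : Shape → Mat₂ Bool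
  shapePattern U = mat₂ true true false true
  shapePattern L = mat₂ true false true true
  shapePattern X = mat₂ false true true true
  shapePattern Y = mat₂ true true true false

  shapeImage : Shape → ℕ → Mat₂ ℕ
  shapeImage U k = mat₂ 1 (2 ℕ.* suc k) 0 1
  shapeImage L k = mat₂ 1 0 (2 ℕ.* suc k) 1
  shapeImage X k = mat₂ 0 1 1 (2 ℕ.* suc k)
  shapeImage Y k = mat₂ (2 ℕ.* suc k) 1 1 0

  Φ-· : ∀ u A → Φ (u · A) ≡ u · Φ A
  Φ-· u (mat a b c d) = mat-≡ (e₁₁ u a b c d) (e₁₂ u a b c d) (e₂₁ u a b c d) (e₂₂ u a b c d)
    where
    e₁₁ : ∀ u a b c d → u * a + u * b + u * c + u * d ≡ u * (a + b + c + d)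
    e₁₁ = solve-∀
    e₁₂ : ∀ u a b c d → - (u * a) + u * b - u * c + u * d ≡ u * (- a + b - c + d)
    e₁₂ = solve-∀
    e₂₁ : ∀ u a b c d → - (u * a) - u * b + u * c + u * d ≡ u * (- a - b + c + d)
    e₂₁ = solve-∀
    e₂₂ : ∀ u a b c d → u * a - u * b - u * c + u * d ≡ u * (a - b - c + d)
    e₂₂ = solve-∀

  ·-2· : ∀ u A → u · (+ 2 · A) ≡ (+ 2 * u) · A
  ·-2· u (mat a b c d) = mat-≡ (entry u a) (entry u b) (entry u c) (entry u d)
    where
    entry : ∀ u x → u * (+ 2 * x) ≡ + 2 * u * x
    entry = solve-∀

  Φ-shapeMat : ∀ τ k → Φ (shapeMat τ (+ k)) ≡ + 2 · toM2 (shapeImage τ k)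
  Φ-shapeMat U k = mat-≡ (e₁₁ (+ k)) (e₁₂ (+ k)) (e₂₁ (+ k)) (e₂₂ (+ k))
    where
    e₁₁ : ∀ x → - + 1 * x + + 1 * (+ 1 + x) + - + 1 * (+ 1 + x) + (+ 2 + x) ≡ + 2 * + 1
    e₁₁ = solve-∀
    e₁₂ : ∀ x → - (- + 1 * x) + + 1 * (+ 1 + x) - - + 1 * (+ 1 + x) + (+ 2 + x) ≡ + 2 * (+ 2 * (+ 1 + x))
    e₁₂ = solve-∀
    e₂₁ : ∀ x → - (- + 1 * x) - + 1 * (+ 1 + x) + - + 1 * (+ 1 + x) + (+ 2 + x) ≡ + 2 * + 0
    e₂₁ = solve-∀
    e₂₂ : ∀ x → - + 1 * x - + 1 * (+ 1 + x) - - + 1 * (+ 1 + x) + (+ 2 + x) ≡ + 2 * + 1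
    e₂₂ = solve-∀
  Φ-shapeMat L k = mat-≡ (e₁₁ (+ k)) (e₁₂ (+ k)) (e₂₁ (+ k)) (e₂₂ (+ k))
    where
    e₁₁ : ∀ x → - + 1 * x + - + 1 * (+ 1 + x) + + 1 * (+ 1 + x) + (+ 2 + x) ≡ + 2 * + 1
    e₁₁ = solve-∀
    e₁₂ : ∀ x → - (- + 1 * x) + - + 1 * (+ 1 + x) - + 1 * (+ 1 + x) + (+ 2 + x) ≡ + 2 * + 0
    e₁₂ = solve-∀
    e₂₁ : ∀ x → - (- + 1 * x) - - + 1 * (+ 1 + x) + + 1 * (+ 1 + x) + (+ 2 + x) ≡ + 2 * (+ 2 * (+ 1 + x))
    e₂₁ = solve-∀
    e₂₂ : ∀ x → - + 1 * x - - + 1 * (+ 1 + x) - + 1 * (+ 1 + x) + (+ 2 + x) ≡ + 2 * + 1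
    e₂₂ = solve-∀
  Φ-shapeMat X k = mat-≡ (e₁₁ (+ k)) (e₁₂ (+ k)) (e₂₁ (+ k)) (e₂₂ (+ k))
    where
    e₁₁ : ∀ x → + 1 * x + - + 1 * (+ 1 + x) + - + 1 * (+ 1 + x) + (+ 2 + x) ≡ + 2 * + 0
    e₁₁ = solve-∀
    e₁₂ : ∀ x → - (+ 1 * x) + - + 1 * (+ 1 + x) - - + 1 * (+ 1 + x) + (+ 2 + x) ≡ + 2 * + 1
    e₁₂ = solve-∀
    e₂₁ : ∀ x → - (+ 1 * x) - - + 1 * (+ 1 + x) + - + 1 * (+ 1 + x) + (+ 2 + x) ≡ + 2 * + 1
    e₂₁ = solve-∀
    e₂₂ : ∀ x → + 1 * x - - + 1 * (+ 1 + x) - - + 1 * (+ 1 + x) + (+ 2 + x) ≡ + 2 * (+ 2 * (+ 1 + x))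
    e₂₂ = solve-∀
  Φ-shapeMat Y k = mat-≡ (e₁₁ (+ k)) (e₁₂ (+ k)) (e₂₁ (+ k)) (e₂₂ (+ k))
    where
    e₁₁ : ∀ x → + 1 * x + + 1 * (+ 1 + x) + + 1 * (+ 1 + x) + (+ 2 + x) ≡ + 2 * (+ 2 * (+ 1 + x))
    e₁₁ = solve-∀
    e₁₂ : ∀ x → - (+ 1 * x) + + 1 * (+ 1 + x) - + 1 * (+ 1 + x) + (+ 2 + x) ≡ + 2 * + 1
    e₁₂ = solve-∀
    e₂₁ : ∀ x → - (+ 1 * x) - + 1 * (+ 1 + x) + + 1 * (+ 1 + x) + (+ 2 + x) ≡ + 2 * + 1
    e₂₁ = solve-∀
    e₂₂ : ∀ x → + 1 * x - + 1 * (+ 1 + x) - + 1 * (+ 1 + x) + (+ 2 + x) ≡ + 2 * + 0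
    e₂₂ = solve-∀

  HasPattern-shape : ∀ {s} τ k → IsSign s → HasPattern (s · shapeMat τ (+ k)) (shapePattern τ)
  HasPattern-shape {s} τ k hs = record
    { sign = s
    ; image = shapeImage τ k
    ; sign-ok = hs
    ; Φ-image = trans (Φ-· s (shapeMat τ (+ k))) (trans (cong (s ·_) (Φ-shapeMat τ k)) (·-2· s (toM2 (shapeImage τ k))))
    ; zero-pattern = pattern-shape τ
    }
    where
    pattern-shape : ∀ τ → zeroPattern (shapeImage τ k) ≡ shapePattern τ
    pattern-shape U = refl
    pattern-shape L = refl
    pattern-shape X = refl
    pattern-shape Y = refl

open ZeroPatterns

full : Mat₂ Bool
full = mat₂ true true true true

shapeOf : Mat₂ Bool → Maybe Shape
shapeOf (mat₂ true true false true) = just U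
shapeOf (mat₂ true false true true) = just L
shapeOf (mat₂ false true true true) = just X
shapeOf (mat₂ true true true false) = just Y
shapeOf _ = nothing

shapeOf-shapePattern : ∀ τ → shapeOf (shapePattern τ) ≡ just τ
shapeOf-shapePattern U = refl
shapeOf-shapePattern L = refl
shapeOf-shapePattern X = refl
shapeOf-shapePattern Y = refl

shapePattern-⊗𝔹^ : ∀ τ r → shapePattern τ ⊗𝔹^ suc r ≡ shapePattern τ ⊎ shapePattern τ ⊗𝔹^ suc r ≡ full
shapePattern-⊗𝔹^ τ zero = inj₁ (⊗-𝟙 τ)
  where
  ⊗-𝟙 : ∀ τ → shapePattern τ ⊗𝔹 𝟙𝔹 ≡ shapePattern τ
  ⊗-𝟙 U = refl
  ⊗-𝟙 L = refl
  ⊗-𝟙 X = refl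
  ⊗-𝟙 Y = refl
shapePattern-⊗𝔹^ τ (suc r) with shapePattern-⊗𝔹^ τ r
... | inj₁ p = Data.Sum.map (trans (cong (shapePattern τ ⊗𝔹_) p)) (trans (cong (shapePattern τ ⊗𝔹_) p)) (square τ)
  where
  square : ∀ τ → shapePattern τ ⊗𝔹 shapePattern τ ≡ shapePattern τ ⊎ shapePattern τ ⊗𝔹 shapePattern τ ≡ full
  square U = inj₁ refl
  square L = inj₁ refl
  square X = inj₂ refl
  square Y = inj₂ refl
... | inj₂ p = inj₂ (trans (cong (shapePattern τ ⊗𝔹_) p) (⊗-full τ))
  where
  ⊗-full : ∀ τ → shapePattern τ ⊗𝔹 full ≡ full
  ⊗-full U = refl
  ⊗-full L = refl
  ⊗-full X = refl
  ⊗-full Y = refl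

-- The solutions of shapePattern c ≡ (shapePattern b ⊗𝔹^ r) ⊗𝔹 shapePattern a with r ≥ 1.
data Transition : Shape → Shape → Shape → Set where
  UUU : Transition U U U
  YUY : Transition Y U Y
  LLL : Transition L L L
  XLX : Transition X L X
  UXX : Transition U X X
  YXL : Transition Y X L
  LYY : Transition L Y Y
  XYU : Transition X Y U

transition : ∀ {a b c} r → shapePattern c ≡ (shapePattern b ⊗𝔹^ suc r) ⊗𝔹 shapePattern a → Transition a b c
transition {a} {b} {c} r c≡ with shapePattern-⊗𝔹^ b r
... | inj₁ p = one-step (trans (sym (shapeOf-shapePattern c)) (cong shapeOf (trans c≡ (cong (_⊗𝔹 shapePattern a) p))))
  where
  one-step : ∀ {a b c} → just c ≡ shapeOf (shapePattern b ⊗𝔹 shapePattern a) → Transition a b c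
  one-step {U} {U} refl = UUU
  one-step {Y} {U} refl = YUY
  one-step {L} {L} refl = LLL
  one-step {X} {L} refl = XLX
  one-step {U} {X} refl = UXX
  one-step {Y} {X} refl = YXL
  one-step {L} {Y} refl = LYY
  one-step {X} {Y} refl = XYU
  one-step {L} {U} ()
  one-step {X} {U} ()
  one-step {U} {L} ()
  one-step {Y} {L} ()
  one-step {L} {X} ()
  one-step {X} {X} ()
  one-step {U} {Y} ()
  one-step {Y} {Y} ()
... | inj₂ p = after-full a (trans (sym (shapeOf-shapePattern c)) (cong shapeOf (trans c≡ (cong (_⊗𝔹 shapePattern a) p))))
  where
  after-full : ∀ {c} a → just c ≡ shapeOf (full ⊗𝔹 shapePattern a) → Transition a b c
  after-full U ()
  after-full L ()
  after-full X ()
  after-full Y ()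

three-transitions⇒stable : ∀ {a b c d e} → Transition a b c → Transition b c d → Transition c d e →
                           b ≡ a × (a ≡ U ⊎ a ≡ L)
three-transitions⇒stable UUU _ _ = refl , inj₁ refl
three-transitions⇒stable LLL _ _ = refl , inj₂ refl
three-transitions⇒stable YUY () _
three-transitions⇒stable XLX () _
three-transitions⇒stable UXX () _
three-transitions⇒stable YXL XLX ()
three-transitions⇒stable LYY () _
three-transitions⇒stable XYU YUY ()

module TriangularConjugates where

  open import Data.Integer using (_+_; _*_)

  tri : ℤ → ℤ → ℤ → M2
  tri l y d = mat l y (+ 0) d

  tri-⊗ : ∀ l y d l′ y′ d′ → tri l y d ⊗ tri l′ y′ d′ ≡ tri (l * l′) (l * y′ + y * d′) (d * d′)
  tri-⊗ l y d l′ y′ d′ = mat-≡ (diagonal₁ l y l′) refl (below d l′) (diagonal₂ d y′ d′)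
    where
    diagonal₁ : ∀ l y l′ → l * l′ + y * + 0 ≡ l * l′
    diagonal₁ = solve-∀
    below : ∀ d l′ → + 0 * l′ + d * + 0 ≡ + 0
    below = solve-∀
    diagonal₂ : ∀ d y′ d′ → + 0 * y′ + d * d′ ≡ d * d′
    diagonal₂ = solve-∀

  ‖tri‖≤ : ∀ {l d K} y → IsSign l → IsSign d → ∣ y ∣ ≤ K → ‖ tri l y d ‖ ≤ suc K
  ‖tri‖≤ {l} {d} y hl hd y≤K = ‖‖-least (tri l y d) (sign≤ hl) (ℕₚ.m≤n⇒m≤1+n y≤K) z≤n (sign≤ hd)
    where
    sign≤ : ∀ {u K} → IsSign u → ∣ u ∣ ≤ suc K
    sign≤ (inj₁ refl) = s≤s z≤n
    sign≤ (inj₂ refl) = s≤s z≤n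

  ∣u*i+j*w∣≤∣j∣+∣i∣ : ∀ {u w} → IsSign u → IsSign w → ∀ i j → ∣ u * i + j * w ∣ ≤ ∣ j ∣ ℕ.+ ∣ i ∣
  ∣u*i+j*w∣≤∣j∣+∣i∣ {u} {w} hu hw i j = begin
    ∣ u * i + j * w ∣        ≤⟨ ℤₚ.∣i+j∣≤∣i∣+∣j∣ (u * i) (j * w) ⟩
    ∣ u * i ∣ ℕ.+ ∣ j * w ∣  ≡⟨ cong₂ ℕ._+_ (IsSign⇒∣u*i∣≡∣i∣ hu i)
                                             (trans (cong ∣_∣ (ℤₚ.*-comm j w)) (IsSign⇒∣u*i∣≡∣i∣ hw j)) ⟩
    ∣ i ∣ ℕ.+ ∣ j ∣          ≡⟨ ℕₚ.+-comm ∣ i ∣ ∣ j ∣ ⟩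
    ∣ j ∣ ℕ.+ ∣ i ∣          ∎
    where open ℕₚ.≤-Reasoning

  -- Y need not be the inverse of X here; the lemmas below assume it where it is needed.
  record TriangularConjugate (X Y : M2) (K : ℕ) (Z : M2) : Set where
    field
      diag₁ corner diag₂ : ℤ
      diag₁-sign : IsSign diag₁
      diag₂-sign : IsSign diag₂
      corner-bound : ∣ corner ∣ ≤ K
      conjugate : Z ≡ X ⊗ (tri diag₁ corner diag₂ ⊗ Y)

  module _ {X Y : M2} where

    open TriangularConjugate

    TriangularConjugate-mono : ∀ {K K′ Z} → K ≤ K′ → TriangularConjugate X Y K Z → TriangularConjugate X Y K′ Z
    TriangularConjugate-mono K≤K′ t = record
      { diag₁ = diag₁ t ; corner = corner t ; diag₂ = diag₂ t ; diag₁-sign = diag₁-sign t ; diag₂-sign = diag₂-sign t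
      ; corner-bound = ℕₚ.≤-trans (corner-bound t) K≤K′ ; conjugate = conjugate t }

    TriangularConjugate-I : X ⊗ Y ≡ I₂ → TriangularConjugate X Y 0 I₂
    TriangularConjugate-I XY≡I = record
      { diag₁ = + 1 ; corner = + 0 ; diag₂ = + 1 ; diag₁-sign = inj₁ refl ; diag₂-sign = inj₁ refl
      ; corner-bound = z≤n ; conjugate = sym (trans (cong (X ⊗_) (⊗-identityˡ Y)) XY≡I) }

    conjugate-⊗ : Y ⊗ X ≡ I₂ → ∀ A B → (X ⊗ (A ⊗ Y)) ⊗ (X ⊗ (B ⊗ Y)) ≡ X ⊗ ((A ⊗ B) ⊗ Y)
    conjugate-⊗ YX≡I A B = begin
      (X ⊗ (A ⊗ Y)) ⊗ (X ⊗ (B ⊗ Y))   ≡⟨ ⊗-assoc X (A ⊗ Y) _ ⟩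
      X ⊗ ((A ⊗ Y) ⊗ (X ⊗ (B ⊗ Y)))   ≡⟨ cong (X ⊗_) (⊗-assoc A Y _) ⟩
      X ⊗ (A ⊗ (Y ⊗ (X ⊗ (B ⊗ Y))))   ≡⟨ cong (λ M → X ⊗ (A ⊗ M)) (sym (⊗-assoc Y X (B ⊗ Y))) ⟩
      X ⊗ (A ⊗ ((Y ⊗ X) ⊗ (B ⊗ Y)))   ≡⟨ cong (λ M → X ⊗ (A ⊗ (M ⊗ (B ⊗ Y)))) YX≡I ⟩
      X ⊗ (A ⊗ (I₂ ⊗ (B ⊗ Y)))        ≡⟨ cong (λ M → X ⊗ (A ⊗ M)) (⊗-identityˡ (B ⊗ Y)) ⟩
      X ⊗ (A ⊗ (B ⊗ Y))               ≡⟨ cong (X ⊗_) (sym (⊗-assoc A B Y)) ⟩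
      X ⊗ ((A ⊗ B) ⊗ Y)               ∎
      where open ≡-Reasoning

    TriangularConjugate-⊗ : Y ⊗ X ≡ I₂ → ∀ {K K′ A B} →
      TriangularConjugate X Y K A → TriangularConjugate X Y K′ B → TriangularConjugate X Y (K ℕ.+ K′) (A ⊗ B)
    TriangularConjugate-⊗ YX≡I {K} {K′} {A} {B} tA tB = record
      { diag₁ = diag₁ tA * diag₁ tB
      ; corner = diag₁ tA * corner tB + corner tA * diag₂ tB
      ; diag₂ = diag₂ tA * diag₂ tB
      ; diag₁-sign = IsSign-* (diag₁-sign tA) (diag₁-sign tB)
      ; diag₂-sign = IsSign-* (diag₂-sign tA) (diag₂-sign tB)
      ; corner-bound = ℕₚ.≤-trans (∣u*i+j*w∣≤∣j∣+∣i∣ (diag₁-sign tA) (diag₂-sign tB) (corner tB) (corner tA))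
                                  (ℕₚ.+-mono-≤ (corner-bound tA) (corner-bound tB))
      ; conjugate = begin
          A ⊗ B                              ≡⟨ cong₂ _⊗_ (conjugate tA) (conjugate tB) ⟩
          (X ⊗ (TA ⊗ Y)) ⊗ (X ⊗ (TB ⊗ Y))    ≡⟨ conjugate-⊗ YX≡I TA TB ⟩
          X ⊗ ((TA ⊗ TB) ⊗ Y)                ≡⟨ cong (λ M → X ⊗ (M ⊗ Y)) (tri-⊗ (diag₁ tA) (corner tA) (diag₂ tA)
                                                                               (diag₁ tB) (corner tB) (diag₂ tB)) ⟩
          X ⊗ (tri (diag₁ tA * diag₁ tB) (diag₁ tA * corner tB + corner tA * diag₂ tB) (diag₂ tA * diag₂ tB) ⊗ Y) ∎
      }
      where
      open ≡-Reasoning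
      TA TB : M2
      TA = tri (diag₁ tA) (corner tA) (diag₂ tA)
      TB = tri (diag₁ tB) (corner tB) (diag₂ tB)

    TriangularConjugate-‖‖ : ∀ {K Z} → TriangularConjugate X Y K Z → ‖ Z ‖ ≤ 4 ℕ.* (‖ X ‖ ℕ.* ‖ Y ‖) ℕ.* suc K
    TriangularConjugate-‖‖ {K} {Z} t = begin
      ‖ Z ‖                                         ≡⟨ cong ‖_‖ (conjugate t) ⟩
      ‖ X ⊗ (T ⊗ Y) ‖                               ≤⟨ ‖‖-⊗ X (T ⊗ Y) ⟩
      2 ℕ.* (‖ X ‖ ℕ.* ‖ T ⊗ Y ‖)                   ≤⟨ ℕₚ.*-monoʳ-≤ 2 (ℕₚ.*-monoʳ-≤ ‖ X ‖ (‖‖-⊗ T Y)) ⟩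
      2 ℕ.* (‖ X ‖ ℕ.* (2 ℕ.* (‖ T ‖ ℕ.* ‖ Y ‖)))   ≤⟨ ℕₚ.*-monoʳ-≤ 2 (ℕₚ.*-monoʳ-≤ ‖ X ‖
                                                       (ℕₚ.*-monoʳ-≤ 2 (ℕₚ.*-monoˡ-≤ ‖ Y ‖ ‖T‖≤))) ⟩
      2 ℕ.* (‖ X ‖ ℕ.* (2 ℕ.* (suc K ℕ.* ‖ Y ‖)))   ≡⟨ regroup ‖ X ‖ ‖ Y ‖ (suc K) ⟩
      4 ℕ.* (‖ X ‖ ℕ.* ‖ Y ‖) ℕ.* suc K             ∎
      where
      open ℕₚ.≤-Reasoning
      T : M2
      T = tri (diag₁ t) (corner t) (diag₂ t)
      ‖T‖≤ : ‖ T ‖ ≤ suc K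
      ‖T‖≤ = ‖tri‖≤ (corner t) (diag₁-sign t) (diag₂-sign t) (corner-bound t)
      regroup : ∀ x y k → 2 ℕ.* (x ℕ.* (2 ℕ.* (k ℕ.* y))) ≡ 4 ℕ.* (x ℕ.* y) ℕ.* k
      regroup = ℕ-Solver.solve-∀

  shear : ℤ → M2
  shear σ = mat (+ 1) (+ 0) σ (+ 1)

  U-conjugate : ∀ {s} k → IsSign s → TriangularConjugate (shear (+ 1)) (shear (- + 1)) (suc k) (s · shapeMat U (+ k))
  U-conjugate {s} k hs = record
    { diag₁ = s ; corner = s * (+ 1 + + k) ; diag₂ = s ; diag₁-sign = hs ; diag₂-sign = hs
    ; corner-bound = ℕₚ.≤-reflexive (IsSign⇒∣u*i∣≡∣i∣ hs (+ suc k))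
    ; conjugate = mat-≡ (e₁₁ s (+ k)) (e₁₂ s (+ k)) (e₂₁ s (+ k)) (e₂₂ s (+ k))
    }
    where
    e₁₁ : ∀ s x → s * (- + 1 * x) ≡ + 1 * (s * + 1 + s * (+ 1 + x) * - + 1) + + 0 * (+ 0 * + 1 + s * - + 1)
    e₁₁ = solve-∀
    e₁₂ : ∀ s x → s * (+ 1 * (+ 1 + x)) ≡ + 1 * (s * + 0 + s * (+ 1 + x) * + 1) + + 0 * (+ 0 * + 0 + s * + 1)
    e₁₂ = solve-∀
    e₂₁ : ∀ s x → s * (- + 1 * (+ 1 + x)) ≡ + 1 * (s * + 1 + s * (+ 1 + x) * - + 1) + + 1 * (+ 0 * + 1 + s * - + 1)
    e₂₁ = solve-∀
    e₂₂ : ∀ s x → s * (+ 2 + x) ≡ + 1 * (s * + 0 + s * (+ 1 + x) * + 1) + + 1 * (+ 0 * + 0 + s * + 1)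
    e₂₂ = solve-∀

  L-conjugate : ∀ {s} k → IsSign s → TriangularConjugate (shear (- + 1)) (shear (+ 1)) (suc k) (s · shapeMat L (+ k))
  L-conjugate {s} k hs = record
    { diag₁ = s ; corner = s * - (+ 1 + + k) ; diag₂ = s ; diag₁-sign = hs ; diag₂-sign = hs
    ; corner-bound = ℕₚ.≤-reflexive (IsSign⇒∣u*i∣≡∣i∣ hs (- + suc k))
    ; conjugate = mat-≡ (e₁₁ s (+ k)) (e₁₂ s (+ k)) (e₂₁ s (+ k)) (e₂₂ s (+ k))
    }
    where
    e₁₁ : ∀ s x → s * (- + 1 * x) ≡ + 1 * (s * + 1 + s * - (+ 1 + x) * + 1) + + 0 * (+ 0 * + 1 + s * + 1)
    e₁₁ = solve-∀
    e₁₂ : ∀ s x → s * (- + 1 * (+ 1 + x)) ≡ + 1 * (s * + 0 + s * - (+ 1 + x) * + 1) + + 0 * (+ 0 * + 0 + s * + 1)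
    e₁₂ = solve-∀
    e₂₁ : ∀ s x → s * (+ 1 * (+ 1 + x)) ≡ - + 1 * (s * + 1 + s * - (+ 1 + x) * + 1) + + 1 * (+ 0 * + 1 + s * + 1)
    e₂₁ = solve-∀
    e₂₂ : ∀ s x → s * (+ 2 + x) ≡ - + 1 * (s * + 0 + s * - (+ 1 + x) * + 1) + + 1 * (+ 0 * + 0 + s * + 1)
    e₂₂ = solve-∀

open TriangularConjugates

module _ {A : Set} where

  take-++ˡ : ∀ n (xs ys : List A) → n ≤ length xs → take n (xs ++ ys) ≡ take n xs
  take-++ˡ zero xs ys _ = refl
  take-++ˡ (suc n) (x ∷ xs) ys (s≤s n≤∣xs∣) = cong (x ∷_) (take-++ˡ n xs ys n≤∣xs∣)

  take-++ʳ : ∀ (xs : List A) n ys → take (length xs ℕ.+ n) (xs ++ ys) ≡ xs ++ take n ys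
  take-++ʳ [] n ys = refl
  take-++ʳ (x ∷ xs) n ys = cong (x ∷_) (take-++ʳ xs n ys)

prefixes-bounded : ∀ {v} (ε α : Fin v → ℤ) w → ∃[ B ] ∀ n → ‖ wordMat ε α (take n w) ‖ ≤ B
prefixes-bounded ε α [] = ‖ I₂ ‖ , λ { zero → ℕₚ.≤-refl ; (suc n) → ℕₚ.≤-refl }
prefixes-bounded ε α (x ∷ w) with prefixes-bounded ε α w
... | B , bound = ‖ I₂ ‖ ℕ.+ 2 ℕ.* (‖ letter ε α x ‖ ℕ.* B) , λ
  { zero → ℕₚ.m≤m+n _ _
  ; (suc n) → ℕₚ.≤-trans (‖‖-⊗ (letter ε α x) (wordMat ε α (take n w)))
                (ℕₚ.≤-trans (ℕₚ.*-monoʳ-≤ 2 (ℕₚ.*-monoʳ-≤ ‖ letter ε α x ‖ (bound n))) (ℕₚ.m≤n+m _ ‖ I₂ ‖))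
  }

module LinearGrowth
  {v : ℕ} (ε α : Fin v → ℤ) {X Y : M2} (XY≡I : X ⊗ Y ≡ I₂) (YX≡I : Y ⊗ X ≡ I₂)
  (W : ℕ → List (Fin v)) (r : ℕ → ℕ) (W-rec : ∀ j → W (suc (suc j)) ≡ wpow (W (suc j)) (r j) ++ W j)
  (W₀-nonempty : 1 ≤ length (W 0)) (W₁-nonempty : 1 ≤ length (W 1))
  (W-conjugate : ∀ j → ∃[ K ] TriangularConjugate X Y K (wordMat ε α (W j)))
  where

  C : ℕ
  C = proj₁ (W-conjugate 0) ℕ.+ proj₁ (W-conjugate 1)

  Tame : List (Fin v) → Set
  Tame w = TriangularConjugate X Y (C ℕ.* length w) (wordMat ε α w)

  Tame-[] : Tame []
  Tame-[] = TriangularConjugate-mono z≤n (TriangularConjugate-I XY≡I)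

  Tame-++ : ∀ u w → Tame u → Tame w → Tame (u ++ w)
  Tame-++ u w tu tw =
    subst₂ (TriangularConjugate X Y) (sym C*∣u++w∣) (sym (wordMat-++ ε α u w)) (TriangularConjugate-⊗ YX≡I tu tw)
    where
    C*∣u++w∣ : C ℕ.* length (u ++ w) ≡ C ℕ.* length u ℕ.+ C ℕ.* length w
    C*∣u++w∣ = trans (cong (C ℕ.*_) (length-++ u)) (ℕₚ.*-distribˡ-+ C (length u) (length w))

  Tame-wpow-++ : ∀ u w → Tame u → Tame w → ∀ r → Tame (wpow u r ++ w)
  Tame-wpow-++ u w tu tw zero = tw
  Tame-wpow-++ u w tu tw (suc r) =
    subst Tame (sym (++-assoc u (wpow u r) w)) (Tame-++ u (wpow u r ++ w) tu (Tame-wpow-++ u w tu tw r))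

  Tame-W : ∀ j → Tame (W j) × Tame (W (suc j))
  Tame-W zero = initial 0 W₀-nonempty (ℕₚ.m≤m+n _ _) , initial 1 W₁-nonempty (ℕₚ.m≤n+m _ _)
    where
    initial : ∀ j → 1 ≤ length (W j) → proj₁ (W-conjugate j) ≤ C → Tame (W j)
    initial j nonempty K≤C = TriangularConjugate-mono
      (ℕₚ.≤-trans K≤C (subst (_≤ C ℕ.* length (W j)) (ℕₚ.*-identityʳ C) (ℕₚ.*-monoʳ-≤ C nonempty)))
      (proj₂ (W-conjugate j))
  Tame-W (suc j) = proj₂ ih , subst Tame (sym (W-rec j)) (Tame-wpow-++ (W (suc j)) (W j) (proj₂ ih) (proj₁ ih) (r j))
    where
    ih : Tame (W j) × Tame (W (suc j))
    ih = Tame-W j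

  B : ℕ
  B = proj₁ (prefixes-bounded ε α (W 0)) ℕ.+ proj₁ (prefixes-bounded ε α (W 1))

  -- A product of whole words of the sequence, followed by a prefix of W 0 or W 1.
  record Split (p : List (Fin v)) : Set where
    field
      head tail : List (Fin v)
      split : p ≡ head ++ tail
      head-tame : Tame head
      tail-bound : ‖ wordMat ε α tail ‖ ≤ B
  open Split

  PrefixesSplit : List (Fin v) → Set
  PrefixesSplit w = ∀ n → Split (take n w)

  Split-tame-++ : ∀ {u p} → Tame u → Split p → Split (u ++ p)
  Split-tame-++ {u} tu s = record
    { head = u ++ head s
    ; tail = tail s
    ; split = trans (cong (u ++_) (split s)) (sym (++-assoc u (head s) (tail s)))
    ; head-tame = Tame-++ u (head s) tu (head-tame s)
    ; tail-bound = tail-bound s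
    }

  PrefixesSplit-++ : ∀ u w → Tame u → PrefixesSplit u → PrefixesSplit w → PrefixesSplit (u ++ w)
  PrefixesSplit-++ u w tu su sw n with ℕₚ.≤-total n (length u)
  ... | inj₁ n≤∣u∣ = subst Split (sym (take-++ˡ n u w n≤∣u∣)) (su n)
  ... | inj₂ ∣u∣≤n with ℕₚ.m≤n⇒∃[o]m+o≡n ∣u∣≤n
  ...   | m , refl = subst Split (sym (take-++ʳ u m w)) (Split-tame-++ tu (sw m))

  PrefixesSplit-wpow-++ : ∀ u w → Tame u → PrefixesSplit u → PrefixesSplit w → ∀ r → PrefixesSplit (wpow u r ++ w)
  PrefixesSplit-wpow-++ u w tu su sw zero = sw
  PrefixesSplit-wpow-++ u w tu su sw (suc r) =
    subst PrefixesSplit (sym (++-assoc u (wpow u r) w))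
          (PrefixesSplit-++ u (wpow u r ++ w) tu su (PrefixesSplit-wpow-++ u w tu su sw r))

  PrefixesSplit-W : ∀ j → PrefixesSplit (W j) × PrefixesSplit (W (suc j))
  PrefixesSplit-W zero = initial 0 (ℕₚ.m≤m+n _ _) , initial 1 (ℕₚ.m≤n+m _ _)
    where
    initial : ∀ j → proj₁ (prefixes-bounded ε α (W j)) ≤ B → PrefixesSplit (W j)
    initial j Bⱼ≤B n = record
      { head = [] ; tail = take n (W j) ; split = refl ; head-tame = Tame-[]
      ; tail-bound = ℕₚ.≤-trans (proj₂ (prefixes-bounded ε α (W j)) n) Bⱼ≤B }
  PrefixesSplit-W (suc j) =
    proj₂ ih , subst PrefixesSplit (sym (W-rec j))
                     (PrefixesSplit-wpow-++ (W (suc j)) (W j) (proj₂ (Tame-W j)) (proj₂ ih) (proj₁ ih) (r j))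
    where
    ih : PrefixesSplit (W j) × PrefixesSplit (W (suc j))
    ih = PrefixesSplit-W j

  κ : ℕ
  κ = 4 ℕ.* (‖ X ‖ ℕ.* ‖ Y ‖)

  D : ℕ
  D = suc (2 ℕ.* (κ ℕ.* suc C ℕ.* B))

  Split-‖‖ : ∀ {n w} → 1 ≤ n → Split (take n w) → ‖ wordMat ε α (take n w) ‖ < D ℕ.* n
  Split-‖‖ {n} {w} n≥1 s = begin-strict
    ‖ wordMat ε α (take n w) ‖
      ≡⟨ cong ‖_‖ (trans (cong (wordMat ε α) (split s)) (wordMat-++ ε α (head s) (tail s))) ⟩
    ‖ wordMat ε α (head s) ⊗ wordMat ε α (tail s) ‖
      ≤⟨ ‖‖-⊗ (wordMat ε α (head s)) (wordMat ε α (tail s)) ⟩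
    2 ℕ.* (‖ wordMat ε α (head s) ‖ ℕ.* ‖ wordMat ε α (tail s) ‖)
      ≤⟨ ℕₚ.*-monoʳ-≤ 2 (ℕₚ.*-mono-≤ (TriangularConjugate-‖‖ (head-tame s)) (tail-bound s)) ⟩
    2 ℕ.* (κ ℕ.* suc (C ℕ.* length (head s)) ℕ.* B)
      ≤⟨ ℕₚ.*-monoʳ-≤ 2 (ℕₚ.*-monoˡ-≤ B (ℕₚ.*-monoʳ-≤ κ (s≤s (ℕₚ.*-monoʳ-≤ C ∣head∣≤n)))) ⟩
    2 ℕ.* (κ ℕ.* suc (C ℕ.* n) ℕ.* B)
      ≤⟨ ℕₚ.*-monoʳ-≤ 2 (ℕₚ.*-monoˡ-≤ B (ℕₚ.*-monoʳ-≤ κ (ℕₚ.+-monoˡ-≤ (C ℕ.* n) n≥1))) ⟩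
    2 ℕ.* (κ ℕ.* (suc C ℕ.* n) ℕ.* B)
      ≡⟨ regroup κ (suc C) n B ⟩
    2 ℕ.* (κ ℕ.* suc C ℕ.* B) ℕ.* n
      <⟨ ℕₚ.+-monoˡ-≤ (2 ℕ.* (κ ℕ.* suc C ℕ.* B) ℕ.* n) n≥1 ⟩
    D ℕ.* n
      ∎
    where
    open ℕₚ.≤-Reasoning
    ∣head∣≤n : length (head s) ≤ n
    ∣head∣≤n = begin
      length (head s)                      ≤⟨ ℕₚ.m≤m+n (length (head s)) (length (tail s)) ⟩
      length (head s) ℕ.+ length (tail s) ≡⟨ sym (trans (cong length (split s)) (length-++ (head s))) ⟩
      length (take n w)                    ≡⟨ length-take n w ⟩
      n ℕ.⊓ length w                       ≤⟨ ℕₚ.m⊓n≤m n (length w) ⟩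
      n                                    ∎
    regroup : ∀ k c n b → 2 ℕ.* (k ℕ.* (c ℕ.* n) ℕ.* b) ≡ 2 ℕ.* (k ℕ.* c ℕ.* b) ℕ.* n
    regroup = ℕ-Solver.solve-∀

  linear-growth : ∃[ D ] 1 ≤ D × ∀ j n → 1 ≤ n → ‖ wordMat ε α (take n (W j)) ‖ < D ℕ.* n
  linear-growth = D , s≤s z≤n , λ j n n≥1 → Split-‖‖ n≥1 (proj₁ (PrefixesSplit-W j) n)

record Triangularisation (Z : ℕ → M2) : Set where
  field
    left right : M2
    left⊗right : left ⊗ right ≡ I₂
    right⊗left : right ⊗ left ≡ I₂
    triangular : ∀ j → ∃[ K ] TriangularConjugate left right K (Z j)

module ShapeStabilisation
  (Z : ℕ → M2) (r : ℕ → ℕ) (r≥1 : ∀ j → 1 ≤ r j)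
  (Z-rec : ∀ j → Z (suc (suc j)) ≡ (Z (suc j) ⊗^ r j) ⊗ Z j)
  (Z-classified : ∀ j → Classified (Z j))
  where

  open Classified

  τ : ℕ → Shape
  τ j = shape (Z-classified j)

  Z-pattern : ∀ j → HasPattern (Z j) (shapePattern (τ j))
  Z-pattern j = subst (λ M → HasPattern M (shapePattern (τ j))) (sym (classified cls))
                      (HasPattern-shape (shape cls) (size cls) (scale-sign cls))
    where
    cls : Classified (Z j)
    cls = Z-classified j

  Z-transition : ∀ j → Transition (τ j) (τ (suc j)) (τ (suc (suc j)))
  Z-transition j with r j | r≥1 j | Z-rec j
  ... | suc r′ | _ | Z-rec′ = transition r′ (HasPattern-unique (Z-pattern (suc (suc j))) product-pattern)
    where
    β : Mat₂ Bool
    β = (shapePattern (τ (suc j)) ⊗𝔹^ suc r′) ⊗𝔹 shapePattern (τ j)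
    product-pattern : HasPattern (Z (suc (suc j))) β
    product-pattern = subst (λ M → HasPattern M β) (sym Z-rec′)
                            (HasPattern-⊗ (HasPattern-⊗^ (Z-pattern (suc j)) (suc r′)) (Z-pattern j))

  τ-stable : ∀ j → τ (suc j) ≡ τ j × (τ j ≡ U ⊎ τ j ≡ L)
  τ-stable j = three-transitions⇒stable (Z-transition j) (Z-transition (suc j)) (Z-transition (suc (suc j)))

  τ-constant : ∀ j → τ j ≡ τ 0
  τ-constant zero = refl
  τ-constant (suc j) = trans (proj₁ (τ-stable j)) (τ-constant j)

  Z≡shape : ∀ {σ} → τ 0 ≡ σ → ∀ j → Z j ≡ scale (Z-classified j) · shapeMat σ (+ size (Z-classified j))
  Z≡shape τ₀≡σ j = trans (classified cls) (cong (λ σ → scale cls · shapeMat σ (+ size cls)) (trans (τ-constant j) τ₀≡σ))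
    where
    cls : Classified (Z j)
    cls = Z-classified j

  triangularisation : Triangularisation Z
  triangularisation with proj₂ (τ-stable 0)
  ... | inj₁ τ₀≡U = record
    { left = shear (+ 1) ; right = shear (- + 1) ; left⊗right = refl ; right⊗left = refl
    ; triangular = λ j → suc (size (Z-classified j)) ,
        subst (TriangularConjugate _ _ _) (sym (Z≡shape τ₀≡U j)) (U-conjugate _ (scale-sign (Z-classified j)))
    }
  ... | inj₂ τ₀≡L = record
    { left = shear (- + 1) ; right = shear (+ 1) ; left⊗right = refl ; right⊗left = refl
    ; triangular = λ j → suc (size (Z-classified j)) ,
        subst (TriangularConjugate _ _ _) (sym (Z≡shape τ₀≡L j)) (L-conjugate _ (scale-sign (Z-classified j)))
    }

wpow-++-prefix : ∀ {A : Set} (u : List A) {r} → 1 ≤ r → ∀ v → ∃[ rest ] wpow u r ++ v ≡ u ++ rest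
wpow-++-prefix u {suc r} _ v = wpow u r ++ v , ++-assoc u (wpow u r) v

module _ {A : Set} (w₁ w₂ : List A) (q : ℕ → ℕ) (q≥1 : ∀ m → 1 ≤ m → 1 ≤ q m) where

  Pword-nonempty : 1 ≤ length w₁ → 1 ≤ length w₂ → ∀ m → 1 ≤ length (Pword w₁ w₂ q (suc m))
  Pword-nonempty ne₁ ne₂ zero = ne₁
  Pword-nonempty ne₁ ne₂ (suc zero) = ne₂
  Pword-nonempty ne₁ ne₂ (suc (suc m)) =
    ℕₚ.≤-trans (Pword-nonempty ne₁ ne₂ m)
               (ℕₚ.≤-trans (ℕₚ.m≤n+m _ _)
                           (ℕₚ.≤-reflexive (sym (length-++ (wpow (Pword w₁ w₂ q (suc (suc m))) (q (suc m)))))))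

  Pword-prefix : ∀ d m → ∃[ rest ] Pword w₁ w₂ q (suc (suc (d ℕ.+ m))) ≡ Pword w₁ w₂ q (suc (suc m)) ++ rest
  Pword-prefix zero m = [] , sym (++-identityʳ _)
  Pword-prefix (suc d) m
    with Pword-prefix d m | wpow-++-prefix P (q≥1 (suc (d ℕ.+ m)) (s≤s z≤n)) (Pword w₁ w₂ q (suc (d ℕ.+ m)))
    where
    P : List A
    P = Pword w₁ w₂ q (suc (suc (d ℕ.+ m)))
  ... | rest₀ , P≡ | rest₁ , P′≡ =
    rest₀ ++ rest₁ , trans P′≡ (trans (cong (_++ rest₁) P≡) (++-assoc (Pword w₁ w₂ q (suc (suc m))) rest₀ rest₁))

  take-Pword : ∀ d m n → n ≤ length (Pword w₁ w₂ q (suc (suc m))) →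
               take n (Pword w₁ w₂ q (suc (suc (d ℕ.+ m)))) ≡ take n (Pword w₁ w₂ q (suc (suc m)))
  take-Pword d m n n≤∣Pₘ∣ with Pword-prefix d m
  ... | rest , P≡ = trans (cong (take n) P≡) (take-++ˡ n (Pword w₁ w₂ q (suc (suc m))) rest n≤∣Pₘ∣)

GoodMat-nonempty : ∀ {v} (ε α : Fin v → ℤ) w → GoodMat (wordMat ε α w) → 1 ≤ length w
GoodMat-nonempty ε α [] (s≤s () , _)
GoodMat-nonempty ε α (x ∷ w) _ = s≤s z≤n

entries<‖‖ : ∀ Z {K} → ‖ Z ‖ < K → (∣ M2.a Z ∣ < K) × (∣ M2.b Z ∣ < K) × (∣ M2.c Z ∣ < K) × (∣ M2.d Z ∣ < K)
entries<‖‖ Z ‖Z‖<K with entries≤‖‖ Z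
... | a≤ , b≤ , c≤ , d≤ =
  ℕₚ.≤-<-trans a≤ ‖Z‖<K , ℕₚ.≤-<-trans b≤ ‖Z‖<K , ℕₚ.≤-<-trans c≤ ‖Z‖<K , ℕₚ.≤-<-trans d≤ ‖Z‖<K

module PwordSequence
  {v : ℕ} (ε α : Fin v → ℤ) (ε-sign : ∀ i → IsSign (ε i))
  (w₁ w₂ : List (Fin v)) (good₁ : GoodMat (wordMat ε α w₁)) (good₂ : GoodMat (wordMat ε α w₂))
  (q : ℕ → ℕ) (q≥1 : ∀ m → 1 ≤ m → 1 ≤ q m)
  (M : ℕ) (eventually-EqCond : ∀ m → m ≥ M → EqCond (wordMat ε α (Pword w₁ w₂ q m)))
  where

  P : ℕ → List (Fin v)
  P = Pword w₁ w₂ q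

  W : ℕ → List (Fin v)
  W j = P (suc (j ℕ.+ M))

  r : ℕ → ℕ
  r j = q (suc (j ℕ.+ M))

  r≥1 : ∀ j → 1 ≤ r j
  r≥1 j = q≥1 (suc (j ℕ.+ M)) (s≤s z≤n)

  W-rec : ∀ j → W (suc (suc j)) ≡ wpow (W (suc j)) (r j) ++ W j
  W-rec j = refl

  Z : ℕ → M2
  Z j = wordMat ε α (W j)

  Z-rec : ∀ j → Z (suc (suc j)) ≡ (Z (suc j) ⊗^ r j) ⊗ Z j
  Z-rec j = trans (wordMat-++ ε α (wpow (W (suc j)) (r j)) (W j)) (cong (_⊗ Z j) (wordMat-wpow ε α (W (suc j)) (r j)))

  Z-classified : ∀ j → Classified (Z j)
  Z-classified j = classify (Z j) (eventually-EqCond (suc (j ℕ.+ M)) (ℕₚ.m≤n+m M (suc j))) (det-wordMat ε α ε-sign (W j))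

  -- This is the only use of the conditions on P₁ and P₂.
  W-nonempty : ∀ j → 1 ≤ length (W j)
  W-nonempty j = Pword-nonempty w₁ w₂ q q≥1 (GoodMat-nonempty ε α w₁ good₁) (GoodMat-nonempty ε α w₂ good₂) (j ℕ.+ M)

  open Triangularisation (ShapeStabilisation.triangularisation Z r r≥1 Z-rec Z-classified)
  open LinearGrowth ε α left⊗right right⊗left W r W-rec (W-nonempty 0) (W-nonempty 1) triangular

  prefixes-linear : ∃[ D ] 1 ≤ D × ∀ n m → 1 ≤ n → 2 ≤ m → n ≤ length (P m) → ‖ wordMat ε α (take n (P m)) ‖ < D ℕ.* n
  prefixes-linear = D , s≤s z≤n , prefix-bound
    where
    prefix-bound : ∀ n m → 1 ≤ n → 2 ≤ m → n ≤ length (P m) → ‖ wordMat ε α (take n (P m)) ‖ < D ℕ.* n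
    prefix-bound n (suc (suc m)) n≥1 (s≤s (s≤s _)) n≤∣Pₘ∣ =
      subst (λ w → ‖ wordMat ε α w ‖ < D ℕ.* n) take≡ (proj₂ (proj₂ linear-growth) (suc (suc m)) n n≥1)
      where
      take≡ : take n (W (suc (suc m))) ≡ take n (P (suc (suc m)))
      take≡ = trans (cong (λ j → take n (P (suc (suc (suc j))))) (ℕₚ.+-comm m M))
                    (take-Pword w₁ w₂ q q≥1 (suc M) m n n≤∣Pₘ∣)

open import Data.Nat using (_*_)

proposition3p2 : (v : ℕ) → 1 ≤ v →
    (ε α : Fin v → ℤ) → (∀ i → ε i ≡ + 1 ⊎ ε i ≡ - (+ 1)) →
    (w₁ w₂ : List (Fin v)) →
    GoodMat (wordMat ε α w₁) → GoodMat (wordMat ε α w₂) →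
    (q : ℕ → ℕ) → (∀ m → 1 ≤ m → 1 ≤ q m) →
    (∃[ M ] ∀ m → m ≥ M → EqCond (wordMat ε α (Pword w₁ w₂ q m))) →
    ∃[ D ] (1 ≤ D ×
      (∀ n m → 1 ≤ n → 2 ≤ m → n ≤ length (Pword w₁ w₂ q m) →
        let Q = wordMat ε α (take n (Pword w₁ w₂ q m)) in
        (∣ M2.a Q ∣ < D * n) × (∣ M2.b Q ∣ < D * n) ×
        (∣ M2.c Q ∣ < D * n) × (∣ M2.d Q ∣ < D * n)))
proposition3p2 v _ ε α ε-sign w₁ w₂ good₁ good₂ q q≥1 (M , eventually-EqCond) =
  proj₁ growth , proj₁ (proj₂ growth) ,
  λ n m n≥1 m≥2 n≤∣Pₘ∣ → entries<‖‖ (wordMat ε α (take n (Pword w₁ w₂ q m))) (proj₂ (proj₂ growth) n m n≥1 m≥2 n≤∣Pₘ∣)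
  where
  open PwordSequence ε α ε-sign w₁ w₂ good₁ good₂ q q≥1 M eventually-EqCond renaming (prefixes-linear to growth)
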